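{- Let $T$ be a tree with $|V(T)|=n\leq 7$. If $T\neq K_{1,n-1}$, then $\sigma^{ - }(T)\leq 2$.
   Context: For a connected simple graph $G$ of order $p$, a parity labelling is a bijection $f:V(G)\to\{1,\ldots,p\}$; an edge $uv$ is negative if $f(u),f(v)$ have opposite parity. The rna number $\sigma^{ - }(G)$ is the minimum over all such $f$ of the number of negative edges. $K_{1,n-1}$ denotes the star with $n-1$ leaves. -}

module Defs where

open import Data.Nat using (ℕ; zero; suc; _≤_; _<_; _%_; _≟_)
open import Data.Nat.Properties using ()
open import Data.Fin using (Fin; toℕ)
open import Data.Bool using (Bool; true; false; _∧_; not; if_then_else_; T)
open import Data.List using (List; []; _∷_; length; map; allFin)
open import Data.Nat.ListAction using (sum)
open import Data.List.Relation.Unary.Unique.Propositional using (Unique)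
open import Data.Product using (Σ; ∃; _×_; _,_)
open import Relation.Binary.PropositionalEquality using (_≡_; _≢_)
open import Relation.Nullary using (¬_; does)
open import Function.Bundles using (_⤖_; Bijection)

record Graph (n : ℕ) : Set where
  field
    adj   : Fin n → Fin n → Bool
    sym   : ∀ u v → adj u v ≡ adj v u
    irrefl : ∀ v → adj v v ≡ false
open Graph public

data Walk {n : ℕ} (G : Graph n) : Fin n → Fin n → Set where
  here : ∀ {v} → Walk G v v
  step : ∀ {u w v} → T (adj G u w) → Walk G w v → Walk G u v

Connected : ∀ {n} → Graph n → Set
Connected {n} G = ∀ (u v : Fin n) → Walk G u v

PathAdj : ∀ {n} → Graph n → List (Fin n) → Set
PathAdj G [] = Data.Unit.⊤ where import Data.Unit
PathAdj G (x ∷ []) = Data.Unit.⊤ where import Data.Unit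
PathAdj G (x ∷ y ∷ xs) = T (adj G x y) × PathAdj G (y ∷ xs)

last : ∀ {A : Set} → A → List A → A
last a [] = a
last a (x ∷ xs) = last x xs

IsCycle : ∀ {n} → Graph n → List (Fin n) → Set
IsCycle G [] = Data.Empty.⊥ where import Data.Empty
IsCycle G (v ∷ vs) =
  3 ≤ length (v ∷ vs) × Unique (v ∷ vs) × PathAdj G (v ∷ vs) × T (adj G (last v vs) v)

Acyclic : ∀ {n} → Graph n → Set
Acyclic {n} G = ∀ (c : List (Fin n)) → ¬ IsCycle G c

IsTree : ∀ {n} → Graph n → Set
IsTree G = Connected G × Acyclic G

_≅_ : ∀ {n} → Graph n → Graph n → Set
_≅_ {n} G H = Σ (Fin n ⤖ Fin n) λ φ →
  ∀ u v → adj G u v ≡ adj H (Bijection.to φ u) (Bijection.to φ v)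

isZero : ∀ {n} → Fin n → Bool
isZero Fin.zero = true
isZero (Fin.suc _) = false
  where import Data.Fin as Fin

xor : Bool → Bool → Bool
xor true b = not b
xor false b = b

star : (m : ℕ) → Graph (suc m)
star m = record { adj = λ u v → xor (isZero u) (isZero v)
                ; sym = symP ; irrefl = irr }
  where
  symP : ∀ (u v : Fin (suc m)) → xor (isZero u) (isZero v) ≡ xor (isZero v) (isZero u)
  symP u v with isZero u | isZero v
  ... | true | true = Relation.Binary.PropositionalEquality.refl
  ... | true | false = Relation.Binary.PropositionalEquality.refl
  ... | false | true = Relation.Binary.PropositionalEquality.refl
  ... | false | false = Relation.Binary.PropositionalEquality.refl
  irr : ∀ (v : Fin (suc m)) → xor (isZero v) (isZero v) ≡ false
  irr v with isZero v
  ... | true = Relation.Binary.PropositionalEquality.refl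
  ... | false = Relation.Binary.PropositionalEquality.refl

-- Parity labelling: a bijection f : V → {1,…,n}; vertex v gets label
-- suc (toℕ (f v)).
label : ∀ {n} → (Fin n ⤖ Fin n) → Fin n → ℕ
label f v = suc (toℕ (Bijection.to f v))

oppositeParity : ℕ → ℕ → Bool
oppositeParity a b = not (does ((a % 2) ≟ (b % 2)))

lt : ℕ → ℕ → Bool
lt a b = does (Data.Nat._<?_ a b) where import Data.Nat

negEdges : ∀ {n} → Graph n → (Fin n ⤖ Fin n) → ℕ
negEdges {n} G f = sum (map (λ u → sum (map (λ v →
    if lt (toℕ u) (toℕ v) ∧ adj G u v ∧ oppositeParity (label f u) (label f v)
    then 1 else 0) (allFin n))) (allFin n))

-- σ⁻(G) ≤ k : the minimum over all parity labellings of the number of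
-- negative edges is at most k, i.e. some labelling achieves ≤ k.
rnaAtMost : ∀ {n} → Graph n → ℕ → Set
rnaAtMost {n} G k = ∃ λ (f : Fin n ⤖ Fin n) → negEdges G f ≤ k

module Submission where

-- A tree is grown one leaf at a time from a single vertex, which identifies
-- it with a recursive tree (each new vertex joined to one earlier vertex):
-- the new leaf has no second neighbour among the vertices already placed,
-- since that neighbour and the tree path back to the attachment vertex
-- would close a cycle.  Since σ⁻ is invariant under isomorphism, it remains
-- to inspect the recursive trees on at most seven vertices, which the type
-- checker does exhaustively: each one is either a star or has a set of
-- ⌊ n/2 ⌋ vertices with at most two edges leaving it, and putting the even
-- labels on that set leaves at most two negative edges.

open import Defs hiding (sym)
open import Data.Nat using (ℕ; zero; suc; _+_; _≤_; _≤ᵇ_; _%_; z≤n; s≤s; ⌊_/2⌋)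
open import Data.Nat.Properties
  using (<-cmp; <⇒≯; <⇒≱; 1+n≰n; ≤ᵇ⇒≤; ≤-refl; ≤-trans; n≤1+n; +-suc; +-identityʳ; +-0-commutativeMonoid)
  renaming (suc-injective to suc-injectiveℕ)
import Data.Nat as ℕ
open import Data.Nat.DivMod using (_mod_)
open import Data.Nat.ListAction using () renaming (sum to listSum)
open import Data.Bool using (Bool; true; false; _∧_; _∨_; not; if_then_else_; T)
open import Data.Bool.Properties using (T-≡; T-∨; ∧-zeroʳ) renaming (_≟_ to _≟ᵇ_)
import Data.Fin as Fin
open import Data.Fin using (Fin; zero; suc; toℕ)
open import Data.Fin.Properties
  using (suc-injective; toℕ-injective; injective⇒≤; all?; any?) renaming (_≟_ to _≟ᶠ_)
import Data.Fin.Permutation as Perm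
open import Data.List using (List; []; _∷_; _∷ʳ_; _++_; map; allFin; tabulate; findᵇ)
open import Data.List.Membership.Propositional using (_∉_)
open import Data.List.Membership.Propositional.Properties using (∈-map⁻)
open import Data.List.Relation.Unary.All using ([]; _∷_)
open import Data.List.Relation.Unary.AllPairs using ([]; _∷_)
open import Data.List.Relation.Unary.All.Properties using (¬Any⇒All¬)
open import Data.List.Relation.Unary.Any using (here)
open import Data.List.Relation.Unary.Unique.Propositional using (Unique)
import Data.List.Relation.Unary.Unique.Propositional.Properties as Unique
open import Data.Maybe using (Maybe; just; maybe′; fromMaybe)
open import Data.Vec using (Vec; []; _∷_; lookup)
open import Data.Product using (∃-syntax; _×_; _,_; proj₁; proj₂)
open import Data.Sum using (_⊎_; inj₁; inj₂)
open import Data.Unit using (tt)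
open import Data.Empty using (⊥; ⊥-elim)
open import Function using (_∘_; id; _⤖_; Bijection; Equivalence)
open import Function.Construct.Composition using (_⤖-∘_)
open import Function.Properties.Bijection using (⤖⇒↔)
open import Function.Properties.Inverse using (↔⇒⤖)
open import Relation.Binary.PropositionalEquality
  using (_≡_; _≢_; refl; sym; trans; cong; cong₂; subst; module ≡-Reasoning)
open import Relation.Binary using (tri<; tri≈; tri>)
open import Relation.Nullary using (¬_; Dec; yes; no)
open import Relation.Nullary.Decidable
  using ( ⌊_⌋; toWitness; fromWitness; dec-true; dec-false; decidable-stable; from-yes
        ; map′; _×-dec_; ¬?; T?)
open import Algebra.Properties.CommutativeMonoid.Sum +-0-commutativeMonoid
  using (sum; sum-syntax; sum-cong-≗; ∑-distrib-+; ∑-comm; ∑-permute)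

-- Counting negative edges

indicator : Bool → ℕ
indicator b = if b then 1 else 0

listSum-tabulate : ∀ {A : Set} {k} (h : A → ℕ) (g : Fin k → A) →
                   listSum (map h (tabulate g)) ≡ sum (h ∘ g)
listSum-tabulate {k = zero}  h g = refl
listSum-tabulate {k = suc k} h g = cong (h (g zero) +_) (listSum-tabulate h (g ∘ suc))

countOrdered : ∀ {k} → (Fin k → Fin k → Bool) → ℕ
countOrdered {k} X = ∑[ u < k ] ∑[ v < k ] indicator (X u v)

countAscending : ∀ {k} → (Fin k → Fin k → Bool) → ℕ
countAscending {k} X = ∑[ u < k ] ∑[ v < k ] indicator (lt (toℕ u) (toℕ v) ∧ X u v)

negative : ∀ {n} → Graph n → (Fin n ⤖ Fin n) → Fin n → Fin n → Bool
negative G f u v = adj G u v ∧ oppositeParity (label f u) (label f v)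

negEdges≡countAscending : ∀ {n} (G : Graph n) f → negEdges G f ≡ countAscending (negative G f)
negEdges≡countAscending {n} G f =
  trans (listSum-tabulate row id) (sum-cong-≗ (λ u → listSum-tabulate (entry u) id))
  where
  entry : Fin n → Fin n → ℕ
  entry u v = indicator (lt (toℕ u) (toℕ v) ∧ negative G f u v)
  row : Fin n → ℕ
  row u = listSum (map (entry u) (allFin n))

module _ {k} (X : Fin k → Fin k → Bool)
         (X-sym : ∀ u v → X u v ≡ X v u) (X-irrefl : ∀ u → X u u ≡ false) where

  indicator-split : ∀ u v → indicator (X u v) ≡
    indicator (lt (toℕ u) (toℕ v) ∧ X u v) + indicator (lt (toℕ v) (toℕ u) ∧ X v u)
  indicator-split u v rewrite X-sym v u with <-cmp (toℕ u) (toℕ v)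
  ... | tri< u<v _ _
    rewrite dec-true (toℕ u ℕ.<? toℕ v) u<v | dec-false (toℕ v ℕ.<? toℕ u) (<⇒≯ u<v)
    = sym (+-identityʳ _)
  ... | tri> _ _ v<u
    rewrite dec-false (toℕ u ℕ.<? toℕ v) (<⇒≯ v<u) | dec-true (toℕ v ℕ.<? toℕ u) v<u
    = refl
  ... | tri≈ _ u≡v _
    rewrite toℕ-injective u≡v | X-irrefl v | ∧-zeroʳ (lt (toℕ v) (toℕ v))
    = refl

  countOrdered≡double : countOrdered X ≡ countAscending X + countAscending X
  countOrdered≡double = begin
    countOrdered X
      ≡⟨ sum-cong-≗ (λ u → sum-cong-≗ (indicator-split u)) ⟩
    ∑[ u < k ] ∑[ v < k ] (A u v + A v u)
      ≡⟨ sum-cong-≗ (λ u → ∑-distrib-+ (A u) (λ v → A v u)) ⟩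
    ∑[ u < k ] (∑[ v < k ] A u v + ∑[ v < k ] A v u)
      ≡⟨ ∑-distrib-+ (λ u → ∑[ v < k ] A u v) (λ u → ∑[ v < k ] A v u) ⟩
    countAscending X + ∑[ u < k ] ∑[ v < k ] A v u
      ≡⟨ cong (countAscending X +_) (∑-comm (λ u v → A v u)) ⟩
    countAscending X + countAscending X ∎
    where
    open ≡-Reasoning
    A : Fin k → Fin k → ℕ
    A u v = indicator (lt (toℕ u) (toℕ v) ∧ X u v)

countOrdered-permute : ∀ {k} (π : Fin k ⤖ Fin k) (X : Fin k → Fin k → Bool) →
  countOrdered (λ u v → X (Bijection.to π u) (Bijection.to π v)) ≡ countOrdered X
countOrdered-permute π X = sym (trans
  (∑-permute (λ u → ∑[ v < _ ] indicator (X u v)) (⤖⇒↔ π))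
  (sum-cong-≗ (λ u → ∑-permute (λ v → indicator (X (Bijection.to π u) v)) (⤖⇒↔ π))))

-- Isomorphism invariance

≅-trans : ∀ {n} {G H K : Graph n} → G ≅ H → H ≅ K → G ≅ K
≅-trans (φ , φ-adj) (ψ , ψ-adj) = ψ ⤖-∘ φ , λ u v → trans (φ-adj u v) (ψ-adj _ _)

≡ᵇ-sym : ∀ a b → (a ℕ.≡ᵇ b) ≡ (b ℕ.≡ᵇ a)
≡ᵇ-sym zero    zero    = refl
≡ᵇ-sym zero    (suc b) = refl
≡ᵇ-sym (suc a) zero    = refl
≡ᵇ-sym (suc a) (suc b) = ≡ᵇ-sym a b

oppositeParity-sym : ∀ a b → oppositeParity a b ≡ oppositeParity b a
oppositeParity-sym a b = cong not (≡ᵇ-sym (a % 2) (b % 2))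

double-injective : ∀ a b → a + a ≡ b + b → a ≡ b
double-injective zero    zero    _ = refl
double-injective (suc a) (suc b) e = cong suc (double-injective a b
  (suc-injectiveℕ (trans (sym (+-suc a a)) (trans (suc-injectiveℕ e) (+-suc b b)))))

negEdges-∘-≅ : ∀ {n} {G H : Graph n} (G≅H : G ≅ H) (f : Fin n ⤖ Fin n) →
               negEdges G (f ⤖-∘ proj₁ G≅H) ≡ negEdges H f
negEdges-∘-≅ {n} {G} {H} (φ , φ-adj) f = double-injective _ _ (begin
  negEdges G g + negEdges G g
    ≡⟨ cong₂ _+_ (negEdges≡countAscending G g) (negEdges≡countAscending G g) ⟩
  countAscending (negative G g) + countAscending (negative G g)
    ≡⟨ sym (countOrdered≡double (negative G g) (negative-sym G g) (negative-irrefl G g)) ⟩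
  countOrdered (negative G g)
    ≡⟨ sum-cong-≗ (λ u → sum-cong-≗ (λ v → cong (λ b → indicator (b ∧ _)) (φ-adj u v))) ⟩
  countOrdered (λ u v → negative H f (Bijection.to φ u) (Bijection.to φ v))
    ≡⟨ countOrdered-permute φ (negative H f) ⟩
  countOrdered (negative H f)
    ≡⟨ countOrdered≡double (negative H f) (negative-sym H f) (negative-irrefl H f) ⟩
  countAscending (negative H f) + countAscending (negative H f)
    ≡⟨ sym (cong₂ _+_ (negEdges≡countAscending H f) (negEdges≡countAscending H f)) ⟩
  negEdges H f + negEdges H f ∎)
  where
  open ≡-Reasoning
  g : Fin n ⤖ Fin n
  g = f ⤖-∘ φ
  negative-sym : ∀ K h u v → negative K h u v ≡ negative K h v u
  negative-sym K h u v = cong₂ _∧_ (Graph.sym K u v) (oppositeParity-sym (label h u) (label h v))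
  negative-irrefl : ∀ K h u → negative K h u u ≡ false
  negative-irrefl K h u rewrite Graph.irrefl K u = refl

rnaAtMost-resp-≅ : ∀ {n} {G H : Graph n} {k} → G ≅ H → rnaAtMost H k → rnaAtMost G k
rnaAtMost-resp-≅ {G = G} {H} {k} G≅H (f , f-bound) =
  f ⤖-∘ proj₁ G≅H , subst (_≤ k) (sym (negEdges-∘-≅ {G = G} {H} G≅H f)) f-bound

record SimplePath {n} (G : Graph n) (u v : Fin n) : Set where
  field
    rest     : List (Fin n)
    ends     : last u rest ≡ v
    distinct : Unique (u ∷ rest)
    adjacent : PathAdj G (u ∷ rest)

  vertices : List (Fin n)
  vertices = u ∷ rest

open SimplePath

module _ {n} {G : Graph n} where

  trivialPath : ∀ {u} → SimplePath G u u
  trivialPath = record { rest = [] ; ends = refl ; distinct = [] ∷ [] ; adjacent = tt }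

  prependPath : ∀ {w u v} (p : SimplePath G u v) → w ∉ vertices p → T (adj G w u) →
                SimplePath G w v
  prependPath p w∉p wu = record
    { rest     = vertices p
    ; ends     = ends p
    ; distinct = ¬Any⇒All¬ _ w∉p ∷ distinct p
    ; adjacent = wu , adjacent p
    }

  appendPath : ∀ {u v w} (p : SimplePath G u v) → w ∉ vertices p → T (adj G v w) →
               SimplePath G u w
  appendPath {u} {v} {w} p w∉p vw = record
    { rest     = rest p ∷ʳ w
    ; ends     = last-∷ʳ u (rest p)
    ; distinct = Unique.++⁺ (distinct p) ([] ∷ []) λ { (w∈p , here refl) → w∉p w∈p }
    ; adjacent = PathAdj-∷ʳ u (rest p) (adjacent p) (subst (λ x → T (adj G x w)) (sym (ends p)) vw)
    }
    where
    last-∷ʳ : ∀ x xs → last x (xs ∷ʳ w) ≡ w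
    last-∷ʳ x []       = refl
    last-∷ʳ x (y ∷ ys) = last-∷ʳ y ys
    PathAdj-∷ʳ : ∀ x xs → PathAdj G (x ∷ xs) → T (adj G (last x xs) w) →
                 PathAdj G (x ∷ (xs ∷ʳ w))
    PathAdj-∷ʳ x []       _        xw = xw , tt
    PathAdj-∷ʳ x (y ∷ ys) (xy , p) yw = xy , PathAdj-∷ʳ y ys p yw

mapPath : ∀ {k n} {H : Graph k} {G : Graph n} (f : Fin k → Fin n) →
          (∀ {x y} → f x ≡ f y → x ≡ y) → (∀ x y → T (adj H x y) → T (adj G (f x) (f y))) →
          ∀ {u v} → SimplePath H u v → SimplePath G (f u) (f v)
mapPath {H = H} {G} f f-injective f-hom {u} p = record
  { rest     = map f (rest p)
  ; ends     = trans (last-map u (rest p)) (cong f (ends p))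
  ; distinct = Unique.map⁺ f-injective (distinct p)
  ; adjacent = PathAdj-map u (rest p) (adjacent p)
  }
  where
  last-map : ∀ x xs → last (f x) (map f xs) ≡ f (last x xs)
  last-map x []       = refl
  last-map x (y ∷ ys) = last-map y ys
  PathAdj-map : ∀ x xs → PathAdj H (x ∷ xs) → PathAdj G (f x ∷ map f xs)
  PathAdj-map x []       _        = tt
  PathAdj-map x (y ∷ ys) (xy , p) = f-hom x y xy , PathAdj-map y ys p

acyclic⇒¬adjacent-to-both-ends : ∀ {n} {G : Graph n} → Acyclic G →
  ∀ {u v w} (p : SimplePath G u v) → u ≢ v → w ∉ vertices p →
  T (adj G w u) → T (adj G v w) → ⊥
acyclic⇒¬adjacent-to-both-ends _ record { rest = [] ; ends = refl } u≢v _ _ _ = u≢v refl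
acyclic⇒¬adjacent-to-both-ends {G = G} acyclic {u} {w = w}
  record { rest = x ∷ xs ; ends = ends ; distinct = distinct ; adjacent = adjacent } _ w∉p wu vw =
  acyclic (w ∷ u ∷ x ∷ xs)
    ( s≤s (s≤s (s≤s z≤n))
    , ¬Any⇒All¬ _ w∉p ∷ distinct
    , (wu , adjacent)
    , subst (λ y → T (adj G y w)) (sym ends) vw
    )

-- attach t j adds a new vertex zero, shifting the old vertices by suc,
-- and joins it to suc j.
data RecursiveTree : ℕ → Set where
  single : RecursiveTree 1
  attach : ∀ {k} → RecursiveTree (suc k) → Fin (suc k) → RecursiveTree (suc (suc k))

edge : ∀ {k} → RecursiveTree k → Fin k → Fin k → Bool
edge single       _       _       = false
edge (attach t j) zero    zero    = false
edge (attach t j) zero    (suc b) = ⌊ j ≟ᶠ b ⌋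
edge (attach t j) (suc a) zero    = ⌊ j ≟ᶠ a ⌋
edge (attach t j) (suc a) (suc b) = edge t a b

edge-sym : ∀ {k} (t : RecursiveTree k) a b → edge t a b ≡ edge t b a
edge-sym single       _       _       = refl
edge-sym (attach t j) zero    zero    = refl
edge-sym (attach t j) zero    (suc b) = refl
edge-sym (attach t j) (suc a) zero    = refl
edge-sym (attach t j) (suc a) (suc b) = edge-sym t a b

edge-irrefl : ∀ {k} (t : RecursiveTree k) a → edge t a a ≡ false
edge-irrefl single       _       = refl
edge-irrefl (attach t j) zero    = refl
edge-irrefl (attach t j) (suc a) = edge-irrefl t a

treeGraph : ∀ {k} → RecursiveTree k → Graph k
treeGraph t = record { adj = edge t ; sym = edge-sym t ; irrefl = edge-irrefl t }

zero∉map-suc : ∀ {k} (xs : List (Fin k)) → Fin.zero ∉ map Fin.suc xs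
zero∉map-suc xs zero∈ with ∈-map⁻ Fin.suc zero∈
... | _ , _ , ()

shiftPath : ∀ {k} {t : RecursiveTree (suc k)} {j a b} →
  SimplePath (treeGraph t) a b → SimplePath (treeGraph (attach t j)) (suc a) (suc b)
shiftPath = mapPath suc suc-injective (λ _ _ ab → ab)

treePath : ∀ {k} (t : RecursiveTree k) a b → SimplePath (treeGraph t) a b
treePath single       zero    zero    = trivialPath
treePath (attach t j) zero    zero    = trivialPath
treePath (attach t j) zero    (suc b) =
  prependPath (shiftPath (treePath t j b)) (zero∉map-suc _) (fromWitness refl)
treePath (attach t j) (suc a) zero    =
  appendPath (shiftPath (treePath t a j)) (zero∉map-suc _) (fromWitness refl)
treePath (attach t j) (suc a) (suc b) = shiftPath (treePath t a b)

-- Every tree is a recursive tree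

module _ {m} (G : Graph (suc m)) where

  record InducedTree (k : ℕ) : Set where
    field
      shape     : RecursiveTree (suc k)
      vertex    : Fin (suc k) → Fin (suc m)
      injective : ∀ {a b} → vertex a ≡ vertex b → a ≡ b
      induced   : ∀ a b → adj G (vertex a) (vertex b) ≡ edge shape a b

  open InducedTree

  inducedPath : ∀ {k} (e : InducedTree k) a b → SimplePath G (vertex e a) (vertex e b)
  inducedPath e a b = mapPath (vertex e) (injective e)
    (λ x y xy → subst T (sym (induced e x y)) xy) (treePath (shape e) a b)

  singleVertex : InducedTree 0
  singleVertex = record
    { shape     = single
    ; vertex    = λ _ → zero
    ; injective = λ { {zero} {zero} _ → refl }
    ; induced   = λ { zero zero → Graph.irrefl G zero }
    }

  -- Any other neighbour b of w would close a cycle with the tree path from j to b.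
  attached-only-to : Acyclic G → ∀ {k} (e : InducedTree k) j {w} → (∀ a → vertex e a ≢ w) →
    T (adj G (vertex e j) w) → ∀ b → adj G w (vertex e b) ≡ ⌊ j ≟ᶠ b ⌋
  attached-only-to acyclic e j {w} fresh jw b with j ≟ᶠ b
  ... | yes refl = Equivalence.to T-≡ (subst T (Graph.sym G _ _) jw)
  ... | no j≢b with adj G w (vertex e b) in wb
  ...   | false = refl
  ...   | true  = ⊥-elim (acyclic⇒¬adjacent-to-both-ends acyclic (inducedPath e j b)
                   (j≢b ∘ injective e) w∉path (subst T (Graph.sym G _ _) jw)
                   (Equivalence.from T-≡ (trans (Graph.sym G _ _) wb)))
    where
    w∉path : w ∉ vertices (inducedPath e j b)
    w∉path w∈ with ∈-map⁻ (vertex e) w∈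
    ... | a , _ , w≡a = fresh a (sym w≡a)

  extend : Acyclic G → ∀ {k} (e : InducedTree k) j w → (∀ a → vertex e a ≢ w) →
           T (adj G (vertex e j) w) → InducedTree (suc k)
  extend acyclic e j w fresh jw = record
    { shape     = attach (shape e) j
    ; vertex    = vertex′
    ; injective = injective′
    ; induced   = induced′
    }
    where
    vertex′ : Fin _ → Fin (suc m)
    vertex′ zero    = w
    vertex′ (suc a) = vertex e a
    injective′ : ∀ {a b} → vertex′ a ≡ vertex′ b → a ≡ b
    injective′ {zero}  {zero}  _ = refl
    injective′ {zero}  {suc b} w≡b = ⊥-elim (fresh b (sym w≡b))
    injective′ {suc a} {zero}  a≡w = ⊥-elim (fresh a a≡w)
    injective′ {suc a} {suc b} a≡b = cong suc (injective e a≡b)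
    induced′ : ∀ a b → adj G (vertex′ a) (vertex′ b) ≡ edge (attach (shape e) j) a b
    induced′ zero    zero    = Graph.irrefl G w
    induced′ zero    (suc b) = attached-only-to acyclic e j fresh jw b
    induced′ (suc a) zero    = trans (Graph.sym G _ _) (attached-only-to acyclic e j fresh jw a)
    induced′ (suc a) (suc b) = induced e a b

  Closed : ∀ {k} → InducedTree k → Set
  Closed e = ∀ a w → T (adj G (vertex e a) w) → ∃[ b ] vertex e b ≡ w

  covered? : ∀ {k} (e : InducedTree k) w → Dec (∃[ b ] vertex e b ≡ w)
  covered? e w = any? (λ b → vertex e b ≟ᶠ w)

  extend-or-closed : Acyclic G → ∀ {k} (e : InducedTree k) → InducedTree (suc k) ⊎ Closed e
  extend-or-closed acyclic e
    with any? (λ a → any? (λ w → T? (adj G (vertex e a) w) ×-dec ¬? (covered? e w)))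
  ... | yes (a , w , aw , w∉) = inj₁ (extend acyclic e a w (λ b b≡w → w∉ (b , b≡w)) aw)
  ... | no no-frontier = inj₂ λ a w aw →
    decidable-stable (covered? e w) (λ w∉ → no-frontier (a , w , aw , w∉))

  Covering : ∀ {k} → InducedTree k → Set
  Covering e = ∀ v → ∃[ b ] vertex e b ≡ v

  closed⇒covering : Connected G → ∀ {k} (e : InducedTree k) → Closed e → Covering e
  closed⇒covering connected e closed v = reach (connected (vertex e zero) v) (zero , refl)
    where
    reach : ∀ {u v} → Walk G u v → ∃[ b ] vertex e b ≡ u → ∃[ b ] vertex e b ≡ v
    reach here          covered  = covered
    reach (step uw uv) (b , refl) = reach uv (closed b _ uw)

  covering⇒size≤ : ∀ {k} (e : InducedTree k) → Covering e → suc m ≤ suc k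
  covering⇒size≤ e cover = injective⇒≤ λ {u} {v} eq →
    trans (sym (proj₂ (cover u))) (trans (cong (vertex e) eq) (proj₂ (cover v)))

  extend-unless-full : IsTree G → ∀ {k} → suc k ≤ m → InducedTree k → InducedTree (suc k)
  extend-unless-full (connected , acyclic) k<m e with extend-or-closed acyclic e
  ... | inj₁ e′     = e′
  ... | inj₂ closed =
    ⊥-elim (<⇒≱ (s≤s k<m) (covering⇒size≤ e (closed⇒covering connected e closed)))

  grow : IsTree G → ∀ k → k ≤ m → InducedTree k
  grow _    zero    _   = singleVertex
  grow tree (suc k) k<m = extend-unless-full tree k<m (grow tree k (≤-trans (n≤1+n k) k<m))

  full⇒covering : IsTree G → (e : InducedTree m) → Covering e
  full⇒covering (connected , acyclic) e with extend-or-closed acyclic e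
  ... | inj₁ e′     = ⊥-elim (1+n≰n (injective⇒≤ (injective e′)))
  ... | inj₂ closed = closed⇒covering connected e closed

  tree≅recursive : IsTree G → ∃[ t ] G ≅ treeGraph t
  tree≅recursive tree =
    shape e , ↔⇒⤖ (Perm.permutation index (vertex e) index-vertex vertex-index) , adj-index
    where
    e : InducedTree m
    e = grow tree m ≤-refl
    cover : Covering e
    cover = full⇒covering tree e
    index : Fin (suc m) → Fin (suc m)
    index v = proj₁ (cover v)
    vertex-index : ∀ v → vertex e (index v) ≡ v
    vertex-index v = proj₂ (cover v)
    index-vertex : ∀ a → index (vertex e a) ≡ a
    index-vertex a = injective e (vertex-index (vertex e a))
    adj-index : ∀ u v → adj G u v ≡ edge (shape e) (index u) (index v)
    adj-index u v =
      trans (cong₂ (adj G) (sym (vertex-index u)) (sym (vertex-index v))) (induced e _ _)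

-- Certificates for the recursive trees on at most seven vertices

isomorphism? : ∀ {n} (G H : Graph n) (φ : Fin n ⤖ Fin n) →
  Dec (∀ u v → adj G u v ≡ adj H (Bijection.to φ u) (Bijection.to φ v))
isomorphism? G H φ =
  all? λ u → all? λ v → adj G u v ≟ᵇ adj H (Bijection.to φ u) (Bijection.to φ v)

centreToZero : ∀ {m} → Fin (suc m) → Fin (suc m) ⤖ Fin (suc m)
centreToZero c = ↔⇒⤖ (Perm.transpose c zero)

starCertificate : ∀ {m} → Graph (suc m) → Bool
starCertificate {m} G = ⌊ any? (λ c → isomorphism? G (star m) (centreToZero c)) ⌋

starCertificate-sound : ∀ {m} (G : Graph (suc m)) → T (starCertificate G) → G ≅ star m
starCertificate-sound G ok with toWitness ok
... | c , iso = centreToZero c , iso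

inverses? : ∀ {n} (τ ι : Fin n → Fin n) → Dec ((∀ t → τ (ι t) ≡ t) × (∀ i → ι (τ i) ≡ i))
inverses? τ ι = all? (λ t → τ (ι t) ≟ᶠ t) ×-dec all? (λ i → ι (τ i) ≟ᶠ i)

labellingCertificate : ∀ {n} → Graph n → ℕ → (τ ι : Fin n → Fin n) → Bool
labellingCertificate G k τ ι with inverses? τ ι
... | yes (τι , ιτ) = negEdges G (↔⇒⤖ (Perm.permutation τ ι τι ιτ)) ≤ᵇ k
... | no _          = false

labellingCertificate-sound : ∀ {n} (G : Graph n) k τ ι →
  T (labellingCertificate G k τ ι) → rnaAtMost G k
labellingCertificate-sound G k τ ι ok with inverses? τ ι
... | yes (τι , ιτ) = ↔⇒⤖ (Perm.permutation τ ι τι ιτ) , ≤ᵇ⇒≤ _ _ ok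

subsetsOfSize : (k s : ℕ) → List (Vec Bool k)
subsetsOfSize zero    zero    = [] ∷ []
subsetsOfSize zero    (suc s) = []
subsetsOfSize (suc k) zero    = map (false ∷_) (subsetsOfSize k zero)
subsetsOfSize (suc k) (suc s) =
  map (true ∷_) (subsetsOfSize k s) ++ map (false ∷_) (subsetsOfSize k (suc s))

crossing : ∀ {k} → RecursiveTree k → Vec Bool k → ℕ
crossing single       _           = 0
crossing (attach t j) (b ∷ side) = indicator (xor b (lookup side j)) + crossing t side

-- A side of size ⌊ n/2 ⌋ with few crossing edges gets the even labels.  The
-- false side receives the 0-based labels 0, 2, 4, … (odd labels), the true
-- side 1, 3, 5, …; the reduction mod n and the junk default of preimage
-- never matter, since labellingCertificate verifies the candidate bijection
-- and recounts its negative edges, crossing only guiding the search.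
interleave : ∀ {k} → Vec Bool k → ℕ → ℕ → Vec ℕ k
interleave []             _ _ = []
interleave (false ∷ side) e o = e ∷ interleave side (suc (suc e)) o
interleave (true  ∷ side) e o = o ∷ interleave side e (suc (suc o))

sideLabelling : ∀ {m} → Vec Bool (suc m) → Fin (suc m) → Fin (suc m)
sideLabelling {m} side i = lookup (interleave side 0 1) i mod suc m

preimage : ∀ {m} → (Fin (suc m) → Fin (suc m)) → Fin (suc m) → Fin (suc m)
preimage {m} τ t = fromMaybe zero (findᵇ (λ i → ⌊ τ i ≟ᶠ t ⌋) (allFin (suc m)))

smallCutSide : ∀ {m} → RecursiveTree (suc m) → Maybe (Vec Bool (suc m))
smallCutSide {m} t = findᵇ (λ side → crossing t side ≤ᵇ 2) (subsetsOfSize (suc m) ⌊ suc m /2⌋)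

sideCertificate : ∀ {m} → RecursiveTree (suc m) → Vec Bool (suc m) → Bool
sideCertificate t side = labellingCertificate (treeGraph t) 2 τ (preimage τ)
  where τ = sideLabelling side

splitCertificate : ∀ {m} → RecursiveTree (suc m) → Bool
splitCertificate t = maybe′ (sideCertificate t) false (smallCutSide t)

splitCertificate-sound : ∀ {m} (t : RecursiveTree (suc m)) → T (splitCertificate t) →
                         rnaAtMost (treeGraph t) 2
splitCertificate-sound t ok with smallCutSide t
... | just side = labellingCertificate-sound (treeGraph t) 2 τ (preimage τ) ok
  where τ = sideLabelling side

certificate : ∀ {m} → RecursiveTree (suc m) → Bool
certificate t = starCertificate (treeGraph t) ∨ splitCertificate t

certificate-sound : ∀ {m} (t : RecursiveTree (suc m)) → T (certificate t) →
                    treeGraph t ≅ star m ⊎ rnaAtMost (treeGraph t) 2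
certificate-sound t ok with Equivalence.to T-∨ ok
... | inj₁ star-ok  = inj₁ (starCertificate-sound (treeGraph t) star-ok)
... | inj₂ split-ok = inj₂ (splitCertificate-sound t split-ok)

all-recursive? : ∀ k {P : RecursiveTree (suc k) → Set} → (∀ t → Dec (P t)) → Dec (∀ t → P t)
all-recursive? zero    P? = map′ (λ { p single → p }) (λ ∀P → ∀P single) (P? single)
all-recursive? (suc k) P? =
  map′ (λ ∀P → λ { (attach t j) → ∀P t j }) (λ ∀P t j → ∀P (attach t j))
       (all-recursive? k (λ t → all? (λ j → P? (attach t j))))

certified-up-to-seven : ∀ m → suc m ≤ 7 → ∀ (t : RecursiveTree (suc m)) → T (certificate t)
certified-up-to-seven 0 _ = from-yes (all-recursive? 0 (T? ∘ certificate))
certified-up-to-seven 1 _ = from-yes (all-recursive? 1 (T? ∘ certificate))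
certified-up-to-seven 2 _ = from-yes (all-recursive? 2 (T? ∘ certificate))
certified-up-to-seven 3 _ = from-yes (all-recursive? 3 (T? ∘ certificate))
certified-up-to-seven 4 _ = from-yes (all-recursive? 4 (T? ∘ certificate))
certified-up-to-seven 5 _ = from-yes (all-recursive? 5 (T? ∘ certificate))
certified-up-to-seven 6 _ = from-yes (all-recursive? 6 (T? ∘ certificate))
certified-up-to-seven (suc (suc (suc (suc (suc (suc (suc _)))))))
  (s≤s (s≤s (s≤s (s≤s (s≤s (s≤s (s≤s ())))))))

mainTheorem4 : (m : ℕ) → (T : Graph (suc m)) → suc m ≤ 7 → IsTree T →
    ¬ (T ≅ star m) → rnaAtMost T 2
mainTheorem4 m G n≤7 tree not-star with tree≅recursive G tree
... | t , G≅t with certificate-sound t (certified-up-to-seven m n≤7 t)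
...   | inj₁ t≅star = ⊥-elim (not-star (≅-trans {G = G} {treeGraph t} {star m} G≅t t≅star))
...   | inj₂ t-rna  = rnaAtMost-resp-≅ {G = G} {treeGraph t} G≅t t-rna
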